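{- Let $\mathcal{C}$ be a colored $(k+1)$-configuration which is also a projective plane. Then there exist an abelian group $G$ and a planar difference set $A\subseteq G$ with $|A|=k+1$ such that $\mathcal{C}$ is isomorphic, as a colored $(k+1)$-configuration, to the colored configuration with point set $G$, line set $G$, a point $p$ incident with a line $l$ iff $p-l\in A$, and incidence $(p,l)$ colored by $p-l\in A$.
   Context: A planar difference set in an abelian group $G$ is a subset $A\subseteq G$ such that every non-identity $g\in G$ can be written as $g=a_1-a_2$ with $a_1,a_2\in A$ in exactly one way. A $k$-configuration consists of finite sets $P$ (points), $L$ (lines) and an incidence relation $R\subseteq P\times L$ such that: (i) there do not exist distinct $p_1,p_2\in P$ and distinct $l_1,l_2\in L$ with $(p_i,l_j)\in R$ for all $i,j$; (ii) each point is incident with exactly $k$ lines; (iii) each line is incident with exactly $k$ points. Its incidence graph has vertex set $P\sqcup L$ and an edge $\{p,l\}$ for each $(p,l)\in R$; the configuration is connected if this graph is. A $k$-edge coloring assigns one of $k$ colors to each edge so that edges sharing a vertex have distinct colors; $\phi_c(v)$ is the neighbor of $v$ along the edge of color $c$. The 6-cycle property: for every vertex $v$ and distinct colors $a,b,c$, $(\phi_c\phi_b\phi_a\phi_c\phi_b\phi_a)(v)=v$. A colored $k$-configuration is a connected $k$-configuration with a $k$-edge coloring of its incidence graph having the 6-cycle property. An isomorphism of colored configurations consists of bijections between the point sets, between the line sets and between the color sets, preserving incidence and mapping the color of each incidence to the color of its image. A projective plane is an incidence structure in which any two distinct points lie on a unique common line, any two distinct lines share a unique common point, and there exist four points no three of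 which are on a common line. -}

module Defs where

open import Data.Bool using (Bool; true)
open import Data.Nat using (ℕ; suc)
open import Data.Fin using (Fin)
open import Data.Fin.Subset using (Subset; _∈_; ∣_∣)
open import Data.Vec using (tabulate)
open import Data.Product using (Σ; Σ-syntax; _×_; proj₁)
open import Data.Sum using (_⊎_; inj₁; inj₂)
open import Data.Empty using (⊥)
open import Relation.Binary.PropositionalEquality using (_≡_; _≢_)
open import Relation.Binary.Construct.Closure.ReflexiveTransitive using (Star)
open import Algebra.Structures using (IsAbelianGroup)
open import Function.Bundles using (_↔_; _⇔_; Inverse)

-- The number of lines through p is the cardinality of
-- the subset {l | inc p l ≡ true} of Fin nL (and dually).

record Configuration (k : ℕ) : Set where
  field
    nP nL : ℕ
    inc   : Fin nP → Fin nL → Bool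
    no-digon  : ∀ p₁ p₂ l₁ l₂ → p₁ ≢ p₂ → l₁ ≢ l₂ →
                inc p₁ l₁ ≡ true → inc p₁ l₂ ≡ true →
                inc p₂ l₁ ≡ true → inc p₂ l₂ ≡ true → ⊥
    point-deg : ∀ p → ∣ tabulate (inc p) ∣ ≡ k
    line-deg  : ∀ l → ∣ tabulate (λ p → inc p l) ∣ ≡ k

module _ {k : ℕ} (C : Configuration k) where
  open Configuration C

  Vertex : Set
  Vertex = Fin nP ⊎ Fin nL

  Adj : Vertex → Vertex → Set
  Adj (inj₁ p) (inj₂ l) = inc p l ≡ true
  Adj (inj₂ l) (inj₁ p) = inc p l ≡ true
  Adj (inj₁ _) (inj₁ _) = ⊥
  Adj (inj₂ _) (inj₂ _) = ⊥

  Connected : Set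
  Connected = ∀ (v w : Vertex) → Star Adj v w

  record IsProjectivePlane : Set where
    field
      two-points : ∀ p₁ p₂ → p₁ ≢ p₂ →
        Σ[ l ∈ Fin nL ] (inc p₁ l ≡ true × inc p₂ l ≡ true ×
          (∀ l' → inc p₁ l' ≡ true → inc p₂ l' ≡ true → l' ≡ l))
      two-lines : ∀ l₁ l₂ → l₁ ≢ l₂ →
        Σ[ p ∈ Fin nP ] (inc p l₁ ≡ true × inc p l₂ ≡ true ×
          (∀ p' → inc p' l₁ ≡ true → inc p' l₂ ≡ true → p' ≡ p))
      quadrangle : Σ[ q ∈ (Fin 4 → Fin nP) ]
        ((∀ i j → q i ≡ q j → i ≡ j) ×
         (∀ i j m → i ≢ j → j ≢ m → i ≢ m → ∀ l →
            inc (q i) l ≡ true → inc (q j) l ≡ true → inc (q m) l ≡ true → ⊥))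

ColStep : ∀ {k} (C : Configuration k) →
  (Fin (Configuration.nP C) → Fin (Configuration.nL C) → Fin k) →
  Fin k → Vertex C → Vertex C → Set
ColStep C col c (inj₁ p) (inj₂ l) = Configuration.inc C p l ≡ true × col p l ≡ c
ColStep C col c (inj₂ l) (inj₁ p) = Configuration.inc C p l ≡ true × col p l ≡ c
ColStep C col c (inj₁ _) (inj₁ _) = ⊥
ColStep C col c (inj₂ _) (inj₂ _) = ⊥

-- Colored k-configurations.  Colors are Fin k; col p l is the color of
-- the edge {p,l} (its value on non-incident pairs is irrelevant).

record ColoredConfig (k : ℕ) : Set where
  field
    config : Configuration k
  open Configuration config
  field
    connected : Connected config
    col       : Fin nP → Fin nL → Fin k
    proper-pt : ∀ p l₁ l₂ → inc p l₁ ≡ true → inc p l₂ ≡ true →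
                col p l₁ ≡ col p l₂ → l₁ ≡ l₂
    proper-ln : ∀ l p₁ p₂ → inc p₁ l ≡ true → inc p₂ l ≡ true →
                col p₁ l ≡ col p₂ l → p₁ ≡ p₂

  field
    six-cycle : ∀ (a b c : Fin k) → a ≢ b → b ≢ c → a ≢ c →
      ∀ v v₁ v₂ v₃ v₄ v₅ v₆ →
      ColStep config col a v v₁ → ColStep config col b v₁ v₂ →
      ColStep config col c v₂ v₃ → ColStep config col a v₃ v₄ →
      ColStep config col b v₄ v₅ → ColStep config col c v₅ v₆ → v₆ ≡ v

-- Finite abelian groups (carrier Fin n, written multiplicatively in the
-- stdlib structure; g - h means g ∙ h ⁻¹).

record FinAbelianGroup : Set where
  field
    order  : ℕ
    _∙_    : Fin order → Fin order → Fin order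
    ε      : Fin order
    _⁻¹    : Fin order → Fin order
    isAbelianGroup : IsAbelianGroup _≡_ _∙_ ε _⁻¹

  _-_ : Fin order → Fin order → Fin order
  g - h = g ∙ (h ⁻¹)

module _ (G : FinAbelianGroup) where
  open FinAbelianGroup G

  IsPlanarDifferenceSet : Subset order → Set
  IsPlanarDifferenceSet A = ∀ g → g ≢ ε →
    Σ[ a₁ ∈ Fin order ] Σ[ a₂ ∈ Fin order ]
      (a₁ ∈ A × a₂ ∈ A × g ≡ a₁ - a₂ ×
       (∀ b₁ b₂ → b₁ ∈ A → b₂ ∈ A → g ≡ b₁ - b₂ → b₁ ≡ a₁ × b₂ ≡ a₂))

  record DiffSetIso {k : ℕ} (C : ColoredConfig k) (A : Subset order) : Set where
    open ColoredConfig C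
    open Configuration config
    field
      onPoints : Fin nP ↔ Fin order
      onLines  : Fin nL ↔ Fin order
      onColors : Fin k ↔ (Σ[ a ∈ Fin order ] (a ∈ A))
      incidence : ∀ p l → (inc p l ≡ true) ⇔
        ((Inverse.to onPoints p - Inverse.to onLines l) ∈ A)
      coloring : ∀ p l → inc p l ≡ true →
        proj₁ (Inverse.to onColors (col p l)) ≡
          Inverse.to onPoints p - Inverse.to onLines l

{-# OPTIONS --safe #-}
-- By the 6-cycle property the maps τ_{a,b} = φ_a ∘ φ_b on points pairwise
-- commute.  By connectedness every point is reached from a base point o by a
-- word in them, and a transitive action by commuting invertible maps is
-- regular, so the points form an abelian group in which p ∙ q applies to q the
-- word leading from o to p.  In this group φ_c(l) = φ_c(l₀) ∙ φ_0(l), where l₀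
-- is the colour-0 line through o; hence p lies on l iff p - φ_0(l) lies on l₀,
-- i.e. the configuration is the development of A = {points of l₀}, with the
-- colours matching the elements of A.  Two distinct lines of a projective plane
-- meet exactly once, which says that A and each proper translate A + g share
-- exactly one point, i.e. A is a planar difference set.
module Submission where

open import Defs
open import Level using (0ℓ)
open import Function.Base using (_∘_)
open import Data.Bool using (Bool; true; false)
import Data.Bool as Bool
open import Data.Nat using (ℕ; suc; _≤_; z≤n; s≤s)
open import Data.Nat.Properties using (n≮n)
open import Data.Fin using (Fin; zero; suc; punchOut)
import Data.Fin as Fin
open import Data.Fin.Properties using (any?; punchOut-injective; suc-injective)
open import Data.Fin.Subset using (Subset; ∣_∣; _∈_)
open import Data.Vec using (tabulate)
open import Data.Vec.Properties using (lookup∘tabulate; []=⇒lookup; lookup⇒[]=)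
open import Data.Vec.Properties.WithK using ([]=-irrelevant)
open import Data.List using (List; []; _∷_; [_]; _++_; map)
open import Data.Product using (Σ-syntax; ∃-syntax; _×_; _,_; proj₁; proj₂; swap)
open import Data.Product.Properties using (Σ-≡,≡→≡)
open import Data.Sum using (inj₁; inj₂)
open import Data.Sum.Properties using (inj₁-injective)
open import Data.Empty using (⊥-elim)
open import Relation.Nullary using (yes; no)
open import Relation.Nullary.Decidable using (_×-dec_)
open import Relation.Binary.PropositionalEquality using (_≡_; _≢_; refl; sym; trans; cong; cong₂; subst; isEquivalence; module ≡-Reasoning)
open import Relation.Binary.Construct.Closure.ReflexiveTransitive as Star using (Star; _◅_)
open import Algebra.Bundles using (AbelianGroup)
open import Algebra.Structures using (IsAbelianGroup)
import Algebra.Properties.AbelianGroup as AbelianGroupProperties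
open import Function.Bundles using (_↔_; _⇔_; Equivalence; mk↔ₛ′; mk⇔)
open import Function.Construct.Identity using (↔-id)

∣tabulate∣≤ : ∀ {n m} (f : Fin n → Bool) (g : ∀ x → f x ≡ true → Fin m) →
  (∀ x y fx fy → g x fx ≡ g y fy → x ≡ y) → ∣ tabulate f ∣ ≤ m
∣tabulate∣≤-head : ∀ {n m} (f : Fin (suc n) → Bool) (g : ∀ x → f x ≡ true → Fin m) →
  (∀ x y fx fy → g x fx ≡ g y fy → x ≡ y) → f zero ≡ true →
  suc ∣ tabulate (f ∘ suc) ∣ ≤ m

∣tabulate∣≤ {0} f g g-inj = z≤n
∣tabulate∣≤ {suc n} f g g-inj with f zero in f₀
... | false = ∣tabulate∣≤ (f ∘ suc) (g ∘ suc) (λ x y fx fy → suc-injective ∘ g-inj _ _ fx fy)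
... | true  = ∣tabulate∣≤-head f g g-inj f₀

∣tabulate∣≤-head {m = 0}  f g g-inj f₀ with () ← g zero f₀
∣tabulate∣≤-head {m = suc m} f g g-inj f₀ = s≤s (∣tabulate∣≤ (f ∘ suc) g′ g′-inj)
  where
  g₀≢ : ∀ x fx → g zero f₀ ≢ g (suc x) fx
  g₀≢ x fx eq with () ← g-inj zero (suc x) f₀ fx eq
  g′ : ∀ x → f (suc x) ≡ true → Fin m
  g′ x fx = punchOut (g₀≢ x fx)
  g′-inj : ∀ x y fx fy → g′ x fx ≡ g′ y fy → x ≡ y
  g′-inj x y fx fy = suc-injective ∘ g-inj _ _ fx fy ∘ punchOut-injective (g₀≢ x fx) (g₀≢ y fy)

colour-occurs : ∀ {n k} (f : Fin n → Bool) (colour : Fin n → Fin (suc k)) →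
  ∣ tabulate f ∣ ≡ suc k →
  (∀ x y → f x ≡ true → f y ≡ true → colour x ≡ colour y → x ≡ y) →
  ∀ c → ∃[ x ] (f x ≡ true × colour x ≡ c)
colour-occurs {k = k} f colour deg proper c
  with any? (λ x → (f x Bool.≟ true) ×-dec (colour x Fin.≟ c))
... | yes found = found
... | no missing = ⊥-elim (n≮n k (subst (_≤ k) deg (∣tabulate∣≤ f other other-inj)))
  where
  c≢ : ∀ x → f x ≡ true → c ≢ colour x
  c≢ x fx c≡ = missing (x , fx , sym c≡)
  other : ∀ x → f x ≡ true → Fin k
  other x fx = punchOut (c≢ x fx)
  other-inj : ∀ x y fx fy → other x fx ≡ other y fy → x ≡ y
  other-inj x y fx fy = proper x y fx fy ∘ punchOut-injective (c≢ x fx) (c≢ y fy)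

run : ∀ {X L : Set} → (L → X → X) → List L → X → X
run step []      x = x
run step (ℓ ∷ w) x = run step w (step ℓ x)

run-++ : ∀ {X L : Set} (step : L → X → X) u w x → run step (u ++ w) x ≡ run step w (run step u x)
run-++ step []      w x = refl
run-++ step (ℓ ∷ u) w x = run-++ step u w (step ℓ x)

module RegularAction
  {X L : Set} (step : L → X → X)
  (step-comm : ∀ ℓ ℓ′ x → step ℓ (step ℓ′ x) ≡ step ℓ′ (step ℓ x))
  (rev : L → L) (step-rev : ∀ ℓ x → step (rev ℓ) (step ℓ x) ≡ x)
  (o : X) (route : X → List L) (route-spec : ∀ x → run step (route x) o ≡ x)
  where

  run-step : ∀ w ℓ x → run step w (step ℓ x) ≡ step ℓ (run step w x)
  run-step []      ℓ x = refl
  run-step (ℓ′ ∷ w) ℓ x = trans (cong (run step w) (step-comm ℓ′ ℓ x)) (run-step w ℓ (step ℓ′ x))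

  run-comm : ∀ u w x → run step u (run step w x) ≡ run step w (run step u x)
  run-comm []      w x = refl
  run-comm (ℓ ∷ u) w x = trans (cong (run step u) (sym (run-step w ℓ x))) (run-comm u w (step ℓ x))

  run-map-rev : ∀ w x → run step (map rev w) (run step w x) ≡ x
  run-map-rev []      x = refl
  run-map-rev (ℓ ∷ w) x = begin
    run step (map rev w) (step (rev ℓ) (run step w (step ℓ x)))  ≡⟨ cong (run step (map rev w) ∘ step (rev ℓ)) (run-step w ℓ x) ⟩
    run step (map rev w) (step (rev ℓ) (step ℓ (run step w x)))  ≡⟨ cong (run step (map rev w)) (step-rev ℓ _) ⟩
    run step (map rev w) (run step w x)                          ≡⟨ run-map-rev w x ⟩
    x                                                            ∎
    where open ≡-Reasoning

  -- Commutativity plus transitivity: a word is determined by its effect on o.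
  run-determined : ∀ u w → run step u o ≡ run step w o → ∀ x → run step u x ≡ run step w x
  run-determined u w uo≡wo x = begin
    run step u x                      ≡⟨ cong (run step u) (route-spec x) ⟨
    run step u (run step (route x) o) ≡⟨ run-comm u (route x) o ⟩
    run step (route x) (run step u o) ≡⟨ cong (run step (route x)) uo≡wo ⟩
    run step (route x) (run step w o) ≡⟨ run-comm (route x) w o ⟩
    run step w (run step (route x) o) ≡⟨ cong (run step w) (route-spec x) ⟩
    run step w x                      ∎
    where open ≡-Reasoning

  infixl 7 _∙_
  _∙_ : X → X → X
  x ∙ y = run step (route x) y

  _⁻¹ : X → X
  x ⁻¹ = run step (map rev (route x)) o

  run-translate : ∀ w x → run step w x ≡ run step w o ∙ x
  run-translate w x = run-determined w (route (run step w o)) (sym (route-spec _)) x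

  ∙-comm : ∀ x y → x ∙ y ≡ y ∙ x
  ∙-comm x y = begin
    run step (route x) y                      ≡⟨ cong (run step (route x)) (route-spec y) ⟨
    run step (route x) (run step (route y) o) ≡⟨ run-comm (route x) (route y) o ⟩
    run step (route y) (run step (route x) o) ≡⟨ cong (run step (route y)) (route-spec x) ⟩
    run step (route y) x                      ∎
    where open ≡-Reasoning

  ∙-assoc : ∀ x y z → (x ∙ y) ∙ z ≡ x ∙ (y ∙ z)
  ∙-assoc x y z = begin
    run step (route (x ∙ y)) z       ≡⟨ run-determined (route (x ∙ y)) (route y ++ route x) same-at-o z ⟩
    run step (route y ++ route x) z  ≡⟨ run-++ step (route y) (route x) z ⟩
    x ∙ (y ∙ z)                      ∎
    where
    open ≡-Reasoning
    same-at-o : run step (route (x ∙ y)) o ≡ run step (route y ++ route x) o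
    same-at-o = begin
      run step (route (x ∙ y)) o                 ≡⟨ route-spec (x ∙ y) ⟩
      x ∙ y                                      ≡⟨ cong (run step (route x)) (route-spec y) ⟨
      run step (route x) (run step (route y) o)  ≡⟨ run-++ step (route y) (route x) o ⟨
      run step (route y ++ route x) o            ∎

  ∙-identityˡ : ∀ x → o ∙ x ≡ x
  ∙-identityˡ = run-determined (route o) [] (route-spec o)

  ∙-inverseʳ : ∀ x → x ∙ x ⁻¹ ≡ o
  ∙-inverseʳ x = begin
    run step (route x) (run step (map rev (route x)) o)  ≡⟨ run-comm (route x) (map rev (route x)) o ⟩
    run step (map rev (route x)) (run step (route x) o)  ≡⟨ run-map-rev (route x) o ⟩
    o                                                    ∎
    where open ≡-Reasoning

  isAbelianGroup : IsAbelianGroup _≡_ _∙_ o _⁻¹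
  isAbelianGroup = record
    { isGroup = record
      { isMonoid = record
        { isSemigroup = record
          { isMagma = record { isEquivalence = isEquivalence ; ∙-cong = cong₂ _∙_ }
          ; assoc = ∙-assoc }
        ; identity = ∙-identityˡ , route-spec }
      ; inverse = (λ x → trans (∙-comm (x ⁻¹) x) (∙-inverseʳ x)) , ∙-inverseʳ
      ; ⁻¹-cong = cong _⁻¹ }
    ; comm = ∙-comm }

module ColourMaps {k : ℕ} (C : ColoredConfig (suc k)) where
  open ColoredConfig C
  open Configuration config

  Colour : Set
  Colour = Fin (suc k)

  colour-at-point : ∀ p c → ∃[ l ] (inc p l ≡ true × col p l ≡ c)
  colour-at-point p = colour-occurs (inc p) (col p) (point-deg p) (proper-pt p)

  colour-at-line : ∀ l c → ∃[ p ] (inc p l ≡ true × col p l ≡ c)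
  colour-at-line l = colour-occurs (λ p → inc p l) (λ p → col p l) (line-deg l) (proper-ln l)

  line : Colour → Fin nP → Fin nL
  line c p = proj₁ (colour-at-point p c)

  point : Colour → Fin nL → Fin nP
  point c l = proj₁ (colour-at-line l c)

  line-inc : ∀ c p → inc p (line c p) ≡ true
  line-inc c p = proj₁ (proj₂ (colour-at-point p c))

  line-col : ∀ c p → col p (line c p) ≡ c
  line-col c p = proj₂ (proj₂ (colour-at-point p c))

  point-inc : ∀ c l → inc (point c l) l ≡ true
  point-inc c l = proj₁ (proj₂ (colour-at-line l c))

  point-col : ∀ c l → col (point c l) l ≡ c
  point-col c l = proj₂ (proj₂ (colour-at-line l c))

  line-unique : ∀ {c p l} → inc p l ≡ true → col p l ≡ c → line c p ≡ l
  line-unique {c} {p} {l} pl pl-c =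
    proper-pt p (line c p) l (line-inc c p) pl (trans (line-col c p) (sym pl-c))

  point-unique : ∀ {c p l} → inc p l ≡ true → col p l ≡ c → point c l ≡ p
  point-unique {c} {p} {l} pl pl-c =
    proper-ln l (point c l) p (point-inc c l) pl (trans (point-col c l) (sym pl-c))

  point∘line : ∀ c p → point c (line c p) ≡ p
  point∘line c p = point-unique (line-inc c p) (line-col c p)

  line∘point : ∀ c l → line c (point c l) ≡ l
  line∘point c l = line-unique (point-inc c l) (point-col c l)

  φ : Colour → Vertex config → Vertex config
  φ c (inj₁ p) = inj₂ (line c p)
  φ c (inj₂ l) = inj₁ (point c l)

  φ-step : ∀ c v → ColStep config col c v (φ c v)
  φ-step c (inj₁ p) = line-inc c p , line-col c p
  φ-step c (inj₂ l) = point-inc c l , point-col c l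

  φ-involutive : ∀ c v → φ c (φ c v) ≡ v
  φ-involutive c (inj₁ p) = cong inj₁ (point∘line c p)
  φ-involutive c (inj₂ l) = cong inj₂ (line∘point c l)

  φ-flip : ∀ {c v w} → φ c w ≡ v → w ≡ φ c v
  φ-flip {c} {v} {w} w↦v = trans (sym (φ-involutive c w)) (cong (φ c) w↦v)

  φ-hexagon : ∀ a b c v → φ c (φ b (φ a v)) ≡ φ a (φ b (φ c v))
  φ-hexagon a b c v with a Fin.≟ c | a Fin.≟ b | b Fin.≟ c
  ... | yes refl | _        | _        = refl
  ... | no _     | yes refl | _        = trans (cong (φ c) (φ-involutive a v)) (sym (φ-involutive a (φ c v)))
  ... | no _     | no _     | yes refl = trans (φ-involutive b (φ a v)) (cong (φ a) (sym (φ-involutive b v)))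
  ... | no a≢c   | no a≢b   | no b≢c   =
    φ-flip (φ-flip (φ-flip (six-cycle a b c a≢b b≢c a≢c v _ _ _ _ _ _
      (φ-step a v) (φ-step b _) (φ-step c _) (φ-step a _) (φ-step b _) (φ-step c _))))

  φ-square : ∀ a b c d v → φ a (φ b (φ c (φ d v))) ≡ φ c (φ d (φ a (φ b v)))
  φ-square a b c d v =
    trans (φ-hexagon c b a (φ d v)) (cong (φ c) (φ-hexagon d a b v))

  Letter : Set
  Letter = Colour × Colour

  τ : Letter → Fin nP → Fin nP
  τ (a , b) p = point a (line b p)

  τ-comm : ∀ ℓ ℓ′ p → τ ℓ (τ ℓ′ p) ≡ τ ℓ′ (τ ℓ p)
  τ-comm (a , b) (c , d) p = inj₁-injective (φ-square a b c d (inj₁ p))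

  τ-swap : ∀ ℓ p → τ (swap ℓ) (τ ℓ p) ≡ p
  τ-swap (a , b) p = trans (cong (point b) (line∘point a (line b p))) (point∘line b p)

  path-word : ∀ {p q} → Star (Adj config) (inj₁ p) (inj₁ q) → Σ[ w ∈ List Letter ] run τ w p ≡ q
  path-word Star.ε = [] , refl
  path-word {p} (_◅_ {j = inj₂ l} pl (_◅_ {j = inj₁ p′} p′l rest)) with path-word rest
  ... | w , w-spec = (col p′ l , col p l) ∷ w , trans (cong (run τ w) τ-step) w-spec
    where
    τ-step : τ (col p′ l , col p l) p ≡ p′
    τ-step = trans (cong (point (col p′ l)) (line-unique pl refl)) (point-unique p′l refl)

module _ (G : FinAbelianGroup) where
  open FinAbelianGroup G

  abelianGroup : AbelianGroup 0ℓ 0ℓ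
  abelianGroup = record { isAbelianGroup = isAbelianGroup }

  open AbelianGroupProperties abelianGroup using (⁻¹-anti-homo-//; xyx⁻¹≈y)
  open IsAbelianGroup isAbelianGroup using (assoc)

  x-[x-y]≡y : ∀ x y → x - (x - y) ≡ y
  x-[x-y]≡y x y = begin
    x ∙ ((x - y) ⁻¹)  ≡⟨ cong (x ∙_) (⁻¹-anti-homo-// x y) ⟩
    x ∙ (y ∙ (x ⁻¹))  ≡⟨ assoc x y (x ⁻¹) ⟨
    (x ∙ y) ∙ (x ⁻¹)  ≡⟨ xyx⁻¹≈y x y ⟩
    y                 ∎
    where open ≡-Reasoning

  TranslatesMeetOnce : Subset order → Set
  TranslatesMeetOnce A = ∀ g → g ≢ ε →
    Σ[ p ∈ Fin order ] (p ∈ A × (p - g) ∈ A × (∀ q → q ∈ A → (q - g) ∈ A → q ≡ p))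

  translatesMeetOnce⇒planar : ∀ {A} → TranslatesMeetOnce A → IsPlanarDifferenceSet G A
  translatesMeetOnce⇒planar {A} meet g g≢ε with meet g g≢ε
  ... | p , p∈A , p-g∈A , p-unique = p , p - g , p∈A , p-g∈A , sym (x-[x-y]≡y p g) , unique
    where
    unique : ∀ b₁ b₂ → b₁ ∈ A → b₂ ∈ A → g ≡ b₁ - b₂ → b₁ ≡ p × b₂ ≡ p - g
    unique b₁ b₂ b₁∈A b₂∈A g≡ = b₁≡p , trans (sym b₁-g≡b₂) (cong (_- g) b₁≡p)
      where
      b₁-g≡b₂ : b₁ - g ≡ b₂
      b₁-g≡b₂ = trans (cong (b₁ -_) g≡) (x-[x-y]≡y b₁ b₂)
      b₁≡p : b₁ ≡ p
      b₁≡p = p-unique b₁ b₁∈A (subst (_∈ A) (sym b₁-g≡b₂) b₂∈A)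

module DifferenceSetModel {k : ℕ} (C : ColoredConfig (suc k)) (o : Fin (Configuration.nP (ColoredConfig.config C))) where
  open ColoredConfig C
  open Configuration config
  open ColourMaps C

  route : Fin nP → List Letter
  route q = proj₁ (path-word (connected (inj₁ o) (inj₁ q)))

  open RegularAction τ τ-comm swap τ-swap o route (λ q → proj₂ (path-word (connected (inj₁ o) (inj₁ q))))

  G : FinAbelianGroup
  G = record { order = nP ; _∙_ = _∙_ ; ε = o ; _⁻¹ = _⁻¹ ; isAbelianGroup = isAbelianGroup }

  open FinAbelianGroup G using (_-_)
  open AbelianGroupProperties (abelianGroup G) using (//-rightDividesˡ; //-rightDividesʳ)

  l₀ : Fin nL
  l₀ = line zero o

  A : Subset nP
  A = tabulate (λ p → inc p l₀)

  A-size : ∣ A ∣ ≡ suc k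
  A-size = line-deg l₀

  ∈A⇒inc : ∀ {p} → p ∈ A → inc p l₀ ≡ true
  ∈A⇒inc {p} p∈A = trans (sym (lookup∘tabulate (λ p → inc p l₀) p)) ([]=⇒lookup p∈A)

  inc⇒∈A : ∀ {p} → inc p l₀ ≡ true → p ∈ A
  inc⇒∈A {p} pl₀ = lookup⇒[]= p A (trans (lookup∘tabulate (λ p → inc p l₀) p) pl₀)

  point-translate : ∀ c l → point c l ≡ point c l₀ ∙ point zero l
  point-translate c l = begin
    point c l                         ≡⟨ cong (point c) (line∘point zero l) ⟨
    run τ [ c , zero ] (point zero l) ≡⟨ run-translate [ c , zero ] (point zero l) ⟩
    point c l₀ ∙ point zero l         ∎
    where open ≡-Reasoning

  inc⇒difference : ∀ {p l} → inc p l ≡ true → p - point zero l ≡ point (col p l) l₀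
  inc⇒difference {p} {l} pl = begin
    p - point zero l                                     ≡⟨ cong (_- point zero l) (point-unique pl refl) ⟨
    point (col p l) l - point zero l                     ≡⟨ cong (_- point zero l) (point-translate (col p l) l) ⟩
    (point (col p l) l₀ ∙ point zero l) - point zero l   ≡⟨ //-rightDividesʳ (point zero l) (point (col p l) l₀) ⟩
    point (col p l) l₀                                   ∎
    where open ≡-Reasoning

  difference⇒inc : ∀ {p l} → (p - point zero l) ∈ A → inc p l ≡ true
  difference⇒inc {p} {l} d∈A = subst (λ q → inc q l ≡ true) p≡ (point-inc c l)
    where
    d = p - point zero l
    c = col d l₀
    open ≡-Reasoning
    p≡ : point c l ≡ p
    p≡ = begin
      point c l                   ≡⟨ point-translate c l ⟩
      point c l₀ ∙ point zero l   ≡⟨ cong (_∙ point zero l) (point-unique (∈A⇒inc d∈A) refl) ⟩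
      d ∙ point zero l            ≡⟨ //-rightDividesˡ (point zero l) p ⟩
      p                           ∎

  colours↔A : Colour ↔ (Σ[ a ∈ Fin nP ] (a ∈ A))
  colours↔A = mk↔ₛ′ to from to∘from (λ c → point-col c l₀)
    where
    to : Colour → Σ[ a ∈ Fin nP ] (a ∈ A)
    to c = point c l₀ , inc⇒∈A (point-inc c l₀)
    from : Σ[ a ∈ Fin nP ] (a ∈ A) → Colour
    from (a , _) = col a l₀
    to∘from : ∀ a → to (from a) ≡ a
    to∘from (a , a∈A) = Σ-≡,≡→≡ (point-unique (∈A⇒inc a∈A) refl , []=-irrelevant _ a∈A)

  inc⇔difference∈A : ∀ p l → (inc p l ≡ true) ⇔ ((p - point zero l) ∈ A)
  inc⇔difference∈A p l = mk⇔ difference∈A difference⇒inc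
    where
    difference∈A : inc p l ≡ true → (p - point zero l) ∈ A
    difference∈A pl = subst (_∈ A) (sym (inc⇒difference pl)) (inc⇒∈A (point-inc (col p l) l₀))

  isomorphism : DiffSetIso G C A
  isomorphism = record
    { onPoints  = ↔-id _
    ; onLines   = mk↔ₛ′ (point zero) (line zero) (point∘line zero) (line∘point zero)
    ; onColors  = colours↔A
    ; incidence = inc⇔difference∈A
    ; coloring  = λ p l pl → sym (inc⇒difference pl)
    }

  inc-line-zero⇔ : ∀ q g → (inc q (line zero g) ≡ true) ⇔ ((q - g) ∈ A)
  inc-line-zero⇔ q g =
    subst (λ h → (inc q (line zero g) ≡ true) ⇔ ((q - h) ∈ A)) (point∘line zero g) (inc⇔difference∈A q (line zero g))

  l₀≢line-zero : ∀ {g} → g ≢ o → l₀ ≢ line zero g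
  l₀≢line-zero {g} g≢o l₀≡ = g≢o (begin
    g                         ≡⟨ point∘line zero g ⟨
    point zero (line zero g)  ≡⟨ cong (point zero) l₀≡ ⟨
    point zero l₀             ≡⟨ point∘line zero o ⟩
    o                         ∎)
    where open ≡-Reasoning

  projective⇒translatesMeetOnce : IsProjectivePlane config → TranslatesMeetOnce G A
  projective⇒translatesMeetOnce PP g g≢o
    with IsProjectivePlane.two-lines PP l₀ (line zero g) (l₀≢line-zero g≢o)
  ... | p , pl₀ , plg , p-unique =
    p , inc⇒∈A pl₀ , Equivalence.to (inc-line-zero⇔ p g) plg ,
    λ q q∈A q-g∈A → p-unique q (∈A⇒inc q∈A) (Equivalence.from (inc-line-zero⇔ q g) q-g∈A)

corollary8p5 : ∀ (k : ℕ) (C : ColoredConfig (suc k)) →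
    IsProjectivePlane (ColoredConfig.config C) →
    Σ[ G ∈ FinAbelianGroup ] Σ[ A ∈ Subset (FinAbelianGroup.order G) ]
      (IsPlanarDifferenceSet G A × ∣ A ∣ ≡ suc k × DiffSetIso G C A)
corollary8p5 k C PP =
  G , A , translatesMeetOnce⇒planar G (projective⇒translatesMeetOnce PP) , A-size , isomorphism
  where open DifferenceSetModel C (proj₁ (IsProjectivePlane.quadrangle PP) zero)
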